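{- Let $K$ be a field of characteristic $0$ complete... more precisely a discretely valued field of mixed characteristic $(0,p)$ with valuation $\nu$ normalized by $\nu(p)=1$ and valuation ring $R$. Let $f(X)=1+\sum_{j\ge0}a_jX^j\in R[[X]]$ with $\nu(a_j)>0$ for all $j$, and suppose there is a real number $B>0$ with $\nu(a_j)\ge B$ for all $j$. Suppose moreover that $f(X)^p$ has only finitely many terms whose coefficients have valuation strictly smaller than $\frac{p}{p-1}$. Then $f(X)$ has only finitely many terms whose coefficients have valuation strictly smaller than $\frac{1}{p-1}$.
   Context: $\nu:K^\times\to\mathbb{Q}$ is a discrete valuation with $\nu(p)=1$, and $R$ is the ring of integers of $K$. -}

module Defs where

open import Level using (Level; _⊔_) renaming (suc to lsuc)
open import Algebra.Bundles using (CommutativeRing)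
open import Data.Nat as ℕ using (ℕ; zero; suc)
open import Data.Nat.Primality using (Prime)
open import Data.Integer as ℤ using (ℤ; +_)
open import Data.Rational as ℚ using (ℚ; 0ℚ; 1ℚ)
open import Data.Product using (Σ; ∃; _×_; _,_)
open import Relation.Nullary using (¬_)
open import Relation.Binary.PropositionalEquality using (_≡_)

-- ℚ extended by +∞ (values of a valuation, with ν(0) = ∞)

data ℚ∞ : Set where
  fin : ℚ → ℚ∞
  ∞   : ℚ∞

infix 4 _≤∞_ _<∞_
data _≤∞_ : ℚ∞ → ℚ∞ → Set where
  fin≤fin : ∀ {a b} → a ℚ.≤ b → fin a ≤∞ fin b
  _≤∞∞    : ∀ x → x ≤∞ ∞

data _<∞_ : ℚ∞ → ℚ∞ → Set where
  fin<fin : ∀ {a b} → a ℚ.< b → fin a <∞ fin b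
  fin<∞   : ∀ a → fin a <∞ ∞

infixl 6 _+∞_
_+∞_ : ℚ∞ → ℚ∞ → ℚ∞
fin a +∞ fin b = fin (a ℚ.+ b)
fin _ +∞ ∞     = ∞
∞     +∞ _     = ∞

_⊓∞_ : ℚ∞ → ℚ∞ → ℚ∞
fin a ⊓∞ fin b = fin (a ℚ.⊓ b)
fin a ⊓∞ ∞     = fin a
∞     ⊓∞ y     = y

-- n / (p - 1) as a rational; only used for primes p (so p ≥ 2).
_/⟨_-1⟩ : ℤ → ℕ → ℚ
n /⟨ suc (suc k) -1⟩ = n ℚ./ suc k
n /⟨ _ -1⟩           = 0ℚ

module _ {c ℓ : Level} (K : CommutativeRing c ℓ) where
  open CommutativeRing K

  natK : ℕ → Carrier
  natK zero    = 0#
  natK (suc n) = 1# + natK n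

record MixedCharDVF (c ℓ : Level) : Set (lsuc (c ⊔ ℓ)) where
  field
    Kring : CommutativeRing c ℓ
  open CommutativeRing Kring public hiding (zero)
  field
    1≉0      : ¬ (1# ≈ 0#)
    inverse  : ∀ x → ¬ (x ≈ 0#) → ∃ λ y → x * y ≈ 1#
    char0    : ∀ n → ¬ (natK Kring (suc n) ≈ 0#)
    p        : ℕ
    p-prime  : Prime p
    ν        : Carrier → ℚ∞
    ν-cong   : ∀ {x y} → x ≈ y → ν x ≡ ν y
    ν-∞      : ∀ x → ν x ≡ ∞ → x ≈ 0#
    ν-0      : ν 0# ≡ ∞
    ν-*      : ∀ x y → ν (x * y) ≡ ν x +∞ ν y
    ν-+      : ∀ x y → (ν x ⊓∞ ν y) ≤∞ ν (x + y)
    ν-p      : ν (natK Kring p) ≡ fin 1ℚ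
    discrete : ∃ λ e → ∀ x → ∀ q → ν x ≡ fin q →
                 ∃ λ (m : ℤ) → q ≡ m ℚ./ suc e

  InR : Carrier → Set
  InR x = fin 0ℚ ≤∞ ν x

  PowerSeries : Set c
  PowerSeries = ℕ → Carrier

  sumTo : ℕ → (ℕ → Carrier) → Carrier
  sumTo zero    g = g zero
  sumTo (suc n) g = sumTo n g + g (suc n)

  _*ₚ_ : PowerSeries → PowerSeries → PowerSeries
  (f *ₚ g) n = sumTo n (λ i → f i * g (n ℕ.∸ i))

  oneₚ : PowerSeries
  oneₚ zero    = 1#
  oneₚ (suc _) = 0#

  _^ₚ_ : PowerSeries → ℕ → PowerSeries
  f ^ₚ zero  = oneₚ
  f ^ₚ suc n = f *ₚ (f ^ₚ n)

  1+ₚ : (ℕ → Carrier) → PowerSeries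
  1+ₚ a zero    = 1# + a zero
  1+ₚ a (suc j) = a (suc j)

  FinitelyManyBelow : ℚ → PowerSeries → Set
  FinitelyManyBelow b f = ∃ λ N → ∀ n → N ℕ.≤ n → fin b ≤∞ ν (f n)

{-# OPTIONS --safe #-}
module Submission where

-- Write f = F + u, where F is a polynomial of degree ≤ N and every coefficient of u has
-- valuation ≥ t. Since p divides the inner binomial coefficients and ν(p) = 1,
-- (F + u)^p ≡ F^p + u^p modulo valuation 1 + t. Adding the monomials of u one at a time,
-- the coefficient of X^(p i) in f^p is congruent to a_i^p for every i > N. If ν(a_i) = t
-- with t < 1/(p-1), then ν(a_i^p) = p t lies below both 1 + t and p/(p-1), which for large i
-- contradicts the hypothesis on f^p. Hence eventually ν(a_i) ≠ t; as ν takes values in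
-- (1/(e+1))ℤ, the eventual lower bound t rises by 1/(e+1), and after finitely many steps it
-- reaches 1/(p-1).

open import Defs
open import Level using (Level)
open import Data.Nat using (ℕ)
open import Data.Integer using (+_)
open import Data.Rational using (ℚ; 0ℚ; _<_)
open import Data.Product using (∃; _×_)

open import Algebra.Bundles using (CommutativeSemiring)
import Algebra.Construct.Pointwise ℕ as Pointwise
open import Algebra.Structures.Biased using (isCommutativeMonoidˡ; isCommutativeSemiringˡ)
open import Data.Empty using (⊥-elim)
open import Data.Fin as Fin using (Fin)
import Data.Fin.Properties as FinP
open import Data.Integer as ℤ using (ℤ)
import Data.Integer.Properties as ℤP
open import Data.Nat as ℕ using (zero; suc; _∸_)
open import Data.Nat.Combinatorics using (_C_; nC1≡n; nCn≡1; nCk+nC[k+1]≡[n+1]C[k+1])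
open import Data.Nat.Divisibility using (_∣_; divides; ∣⇒≤)
open import Data.Nat.Primality using (Prime; euclidsLemma)
import Data.Nat.Properties as ℕP
open import Data.Nat.Solver using (module +-*-Solver)
open import Data.Product using (_,_; proj₁; proj₂)
open import Data.Rational as ℚ using (1ℚ; _/_; _≤_; toℚᵘ)
open import Algebra.Definitions.RawMonoid ℚ.+-0-rawMonoid using () renaming (_×_ to _×ℚ_)
import Data.Rational.Properties as ℚP
import Data.Rational.Unnormalised as ℚᵘ
import Data.Rational.Unnormalised.Properties as ℚᵘP
open import Data.Sum using (inj₁; inj₂)
open import Function using (_∘_; _$_)
open import Relation.Binary.PropositionalEquality as ≡ using (_≡_; _≢_)
open import Relation.Binary.Definitions using (tri<; tri≈; tri>)
open import Relation.Nullary using (yes; no)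

-- Extended rationals and rational arithmetic

≤∞-refl : ∀ {x} → x ≤∞ x
≤∞-refl {fin x} = fin≤fin ℚP.≤-refl
≤∞-refl {∞}     = ∞ ≤∞∞

≤∞-trans : ∀ {x y z} → x ≤∞ y → y ≤∞ z → x ≤∞ z
≤∞-trans (fin≤fin a≤b) (fin≤fin b≤c) = fin≤fin (ℚP.≤-trans a≤b b≤c)
≤∞-trans {x} _         (_ ≤∞∞)       = x ≤∞∞

fin≤fin⁻¹ : ∀ {a b} → fin a ≤∞ fin b → a ≤ b
fin≤fin⁻¹ (fin≤fin a≤b) = a≤b

<∞⇒≤∞ : ∀ {x y} → x <∞ y → x ≤∞ y
<∞⇒≤∞ (fin<fin a<b) = fin≤fin (ℚP.<⇒≤ a<b)
<∞⇒≤∞ (fin<∞ a)     = fin a ≤∞∞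

fin-injective : ∀ {a b} → fin a ≡ fin b → a ≡ b
fin-injective ≡.refl = ≡.refl

⊓∞-glb : ∀ {x y z} → x ≤∞ y → x ≤∞ z → x ≤∞ y ⊓∞ z
⊓∞-glb (fin≤fin a≤b) (fin≤fin a≤c) = fin≤fin (ℚP.⊓-glb a≤b a≤c)
⊓∞-glb (fin≤fin a≤b) (_ ≤∞∞)       = fin≤fin a≤b
⊓∞-glb (_ ≤∞∞)       x≤z           = x≤z

+∞-mono-≤ : ∀ {a b x y} → fin a ≤∞ x → fin b ≤∞ y → fin (a ℚ.+ b) ≤∞ x +∞ y
+∞-mono-≤ (fin≤fin a≤c) (fin≤fin b≤d) = fin≤fin (ℚP.+-mono-≤ a≤c b≤d)
+∞-mono-≤ (fin≤fin _)   (_ ≤∞∞)       = _ ≤∞∞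
+∞-mono-≤ (_ ≤∞∞)       _             = _ ≤∞∞

q+q≡0⇒0≤q : ∀ q → q ℚ.+ q ≡ 0ℚ → 0ℚ ≤ q
q+q≡0⇒0≤q q q+q≡0 = ℚP.≮⇒≥ λ q<0 →
  ℚP.<-irrefl (≡.trans q+q≡0 (≡.sym (ℚP.+-identityʳ 0ℚ))) (ℚP.+-mono-< {q} {0ℚ} {q} {0ℚ} q<0 q<0)

⊓-glb-strict : ∀ {a b c} → a < b → a < c → a < b ℚ.⊓ c
⊓-glb-strict {a} {b} {c} a<b a<c with ℚP.⊓-sel b c
... | inj₁ b⊓c≡b = ≡.subst (a <_) (≡.sym b⊓c≡b) a<b
... | inj₂ b⊓c≡c = ≡.subst (a <_) (≡.sym b⊓c≡c) a<c

private
  toℚᵘ-/ : ∀ i d → toℚᵘ (i / suc d) ℚᵘ.≃ ℚᵘ.mkℚᵘ i d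
  toℚᵘ-/ i d = ℚP.toℚᵘ-fromℚᵘ (ℚᵘ.mkℚᵘ i d)

/-monoˡ-≤ : ∀ d {i j} → i ℤ.≤ j → i / suc d ≤ j / suc d
/-monoˡ-≤ d {i} {j} i≤j = ℚP.toℚᵘ-cancel-≤
  (ℚᵘP.≤-respˡ-≃ (ℚᵘP.≃-sym (toℚᵘ-/ i d)) (ℚᵘP.≤-respʳ-≃ (ℚᵘP.≃-sym (toℚᵘ-/ j d))
    (ℚᵘ.*≤* (ℤP.*-monoʳ-≤-nonNeg (+ suc d) i≤j))))

/-cancelˡ-≤ : ∀ d {i j} → i / suc d ≤ j / suc d → i ℤ.≤ j
/-cancelˡ-≤ d {i} {j} i/d≤j/d
  with ℚᵘP.≤-respˡ-≃ (toℚᵘ-/ i d) (ℚᵘP.≤-respʳ-≃ (toℚᵘ-/ j d) (ℚP.toℚᵘ-mono-≤ i/d≤j/d))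
... | ℚᵘ.*≤* id≤jd = ℤP.*-cancelʳ-≤-pos i j (+ suc d) id≤jd

/-≤∧≢⇒suc≤ : ∀ d k {m} → + k / suc d ≤ m / suc d → m ≢ + k → + suc k / suc d ≤ m / suc d
/-≤∧≢⇒suc≤ d k k/d≤m/d m≢k =
  /-monoˡ-≤ d (ℤP.i<j⇒suc[i]≤j (ℤP.≤∧≢⇒< (/-cancelˡ-≤ d k/d≤m/d) (m≢k ∘ ≡.sym)))

/-+ : ∀ d i j → i / suc d ℚ.+ j / suc d ≡ (i ℤ.+ j) / suc d
/-+ d i j = ℚP.toℚᵘ-injective (ℚᵘP.≃-trans (ℚP.toℚᵘ-homo-+ (i / suc d) (j / suc d))
  (ℚᵘP.≃-trans (ℚᵘP.+-cong (toℚᵘ-/ i d) (toℚᵘ-/ j d))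
  (ℚᵘP.≃-trans (ℚᵘ.*≡* cross) (ℚᵘP.≃-sym (toℚᵘ-/ (i ℤ.+ j) d)))))
  where
  D : ℤ
  D = + suc d
  cross : (i ℤ.* D ℤ.+ j ℤ.* D) ℤ.* D ≡ (i ℤ.+ j) ℤ.* (D ℤ.* D)
  cross = ≡.trans (≡.cong (ℤ._* D) (≡.sym (ℤP.*-distribʳ-+ D i j))) (ℤP.*-assoc (i ℤ.+ j) D D)

n/n≡1 : ∀ d → + suc d / suc d ≡ 1ℚ
n/n≡1 d = ℚP.toℚᵘ-injective (ℚᵘP.≃-trans (toℚᵘ-/ (+ suc d) d) (ℚᵘ.*≡* (ℤP.*-comm (+ suc d) (+ 1))))

1/n≤1 : ∀ d → + 1 / suc d ≤ 1ℚ
1/n≤1 d = ≡.subst (+ 1 / suc d ≤_) (n/n≡1 d) (/-monoˡ-≤ d {+ 1} {+ suc d} (ℤ.+≤+ (ℕ.s≤s ℕ.z≤n)))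

×ℚ-monoʳ-≤ : ∀ n {s t} → s ≤ t → n ×ℚ s ≤ n ×ℚ t
×ℚ-monoʳ-≤ zero    _   = ℚP.≤-refl
×ℚ-monoʳ-≤ (suc n) s≤t = ℚP.+-mono-≤ s≤t (×ℚ-monoʳ-≤ n s≤t)

×ℚ-monoʳ-< : ∀ n {s t} → s < t → suc n ×ℚ s < suc n ×ℚ t
×ℚ-monoʳ-< n s<t = ℚP.+-mono-<-≤ s<t (×ℚ-monoʳ-≤ n (ℚP.<⇒≤ s<t))

×ℚ-1/ : ∀ d n → n ×ℚ (+ 1 / suc d) ≡ + n / suc d
×ℚ-1/ d zero    = ≡.sym (ℚP.0/n≡0 (suc d))
×ℚ-1/ d (suc n) = ≡.trans (≡.cong (+ 1 / suc d ℚ.+_) (×ℚ-1/ d n)) (/-+ d (+ 1) (+ n))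

module _ (k : ℕ) {t : ℚ} (t<1/[p-1] : t < + 1 / suc k) where
  open ℚP.≤-Reasoning

  p×t<1+t : suc (suc k) ×ℚ t < 1ℚ ℚ.+ t
  p×t<1+t = begin-strict
    t ℚ.+ suc k ×ℚ t              <⟨ ℚP.+-monoʳ-< t (×ℚ-monoʳ-< k t<1/[p-1]) ⟩
    t ℚ.+ suc k ×ℚ (+ 1 / suc k)  ≡⟨ ≡.cong (t ℚ.+_) (≡.trans (×ℚ-1/ k (suc k)) (n/n≡1 k)) ⟩
    t ℚ.+ 1ℚ                      ≡⟨ ℚP.+-comm t 1ℚ ⟩
    1ℚ ℚ.+ t                      ∎

  p×t<p/[p-1] : suc (suc k) ×ℚ t < + suc (suc k) / suc k
  p×t<p/[p-1] = ≡.subst (suc (suc k) ×ℚ t <_) (×ℚ-1/ k (suc (suc k))) (×ℚ-monoʳ-< (suc k) t<1/[p-1])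

-- Binomial coefficients

[1+k]*[1+n]C[1+k]≡[1+n]*nCk : ∀ n k → suc k ℕ.* (suc n C suc k) ≡ suc n ℕ.* (n C k)
[1+k]*[1+n]C[1+k]≡[1+n]*nCk zero    zero    = ≡.refl
[1+k]*[1+n]C[1+k]≡[1+n]*nCk zero    (suc k) = ℕP.*-zeroʳ (suc (suc k))
[1+k]*[1+n]C[1+k]≡[1+n]*nCk (suc n) zero    =
  ≡.trans (ℕP.+-identityʳ _) (≡.trans (nC1≡n (suc (suc n))) (≡.sym (ℕP.*-identityʳ (suc (suc n)))))
[1+k]*[1+n]C[1+k]≡[1+n]*nCk (suc n) (suc k) = begin
  suc (suc k) ℕ.* (suc (suc n) C suc (suc k))
    ≡⟨ ≡.cong (suc (suc k) ℕ.*_) (≡.sym (nCk+nC[k+1]≡[n+1]C[k+1] (suc n) (suc k))) ⟩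
  suc (suc k) ℕ.* (A ℕ.+ B)
    ≡⟨ solve 3 (λ k A B → (con 2 :+ k) :* (A :+ B) := A :+ (con 1 :+ k) :* A :+ (con 2 :+ k) :* B) ≡.refl k A B ⟩
  A ℕ.+ suc k ℕ.* A ℕ.+ suc (suc k) ℕ.* B
    ≡⟨ ≡.cong₂ (λ x y → A ℕ.+ x ℕ.+ y) ([1+k]*[1+n]C[1+k]≡[1+n]*nCk n k) ([1+k]*[1+n]C[1+k]≡[1+n]*nCk n (suc k)) ⟩
  A ℕ.+ suc n ℕ.* (n C k) ℕ.+ suc n ℕ.* (n C suc k)
    ≡⟨ solve 4 (λ n A x y → A :+ (con 1 :+ n) :* x :+ (con 1 :+ n) :* y := A :+ (con 1 :+ n) :* (x :+ y))
               ≡.refl n A (n C k) (n C suc k) ⟩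
  A ℕ.+ suc n ℕ.* (n C k ℕ.+ n C suc k)
    ≡⟨ ≡.cong (λ x → A ℕ.+ suc n ℕ.* x) (nCk+nC[k+1]≡[n+1]C[k+1] n k) ⟩
  A ℕ.+ suc n ℕ.* A
    ∎
  where
  open ≡.≡-Reasoning
  open +-*-Solver
  A B : ℕ
  A = suc n C suc k
  B = suc n C suc (suc k)

p∣pCk : ∀ {p k} → Prime p → 0 ℕ.< k → k ℕ.< p → p ∣ p C k
p∣pCk {suc p-1} {suc k-1} p-prime _ k<p
  with euclidsLemma (suc k-1) (suc p-1 C suc k-1) p-prime
         (divides (p-1 C k-1) (≡.trans ([1+k]*[1+n]C[1+k]≡[1+n]*nCk p-1 k-1) (ℕP.*-comm (suc p-1) _)))
... | inj₁ p∣k   = ⊥-elim (ℕP.<⇒≱ k<p (∣⇒≤ p∣k))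
... | inj₂ p∣pCk = p∣pCk

module _ {c ℓ : Level} (K : MixedCharDVF c ℓ) where
  open MixedCharDVF K hiding (p; p-prime; ν-p)
  open import Relation.Binary.Reasoning.Setoid setoid
  open import Algebra.Properties.CommutativeSemigroup +-commutativeSemigroup using (interchange)
  open import Algebra.Properties.Semiring.Exp semiring using (_^_)
  open import Algebra.Properties.Ring ring using (-1*x≈-x; -‿involutive)
  open import Algebra.Properties.AbelianGroup +-abelianGroup
    using (x≈y⇒x∙y⁻¹≈ε; ⁻¹-∙-comm; ⁻¹-anti-homo‿-; xyx⁻¹≈y)
  open import Algebra.Properties.Group ℚP.+-0-group using () renaming (identityʳ-unique to ℚ-+-identityʳ-unique)

  -- Finite sums and the semiring of power series

  sumTo-cong : ∀ n {g h} → (∀ i → i ℕ.≤ n → g i ≈ h i) → sumTo n g ≈ sumTo n h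
  sumTo-cong zero    g≈h = g≈h 0 ℕ.z≤n
  sumTo-cong (suc n) g≈h = +-cong (sumTo-cong n (λ i i≤n → g≈h i (ℕP.m≤n⇒m≤1+n i≤n))) (g≈h (suc n) ℕP.≤-refl)

  sumTo-+ : ∀ n g h → sumTo n (λ i → g i + h i) ≈ sumTo n g + sumTo n h
  sumTo-+ zero    g h = refl
  sumTo-+ (suc n) g h = trans (+-congʳ (sumTo-+ n g h)) (interchange _ _ _ _)

  sumTo-*ˡ : ∀ n x g → x * sumTo n g ≈ sumTo n (λ i → x * g i)
  sumTo-*ˡ zero    x g = refl
  sumTo-*ˡ (suc n) x g = trans (distribˡ x _ _) (+-congʳ (sumTo-*ˡ n x g))

  sumTo-*ʳ : ∀ n x g → sumTo n g * x ≈ sumTo n (λ i → g i * x)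
  sumTo-*ʳ zero    x g = refl
  sumTo-*ʳ (suc n) x g = trans (distribʳ x _ _) (+-congʳ (sumTo-*ʳ n x g))

  sumTo-zero : ∀ n {g} → (∀ i → i ℕ.≤ n → g i ≈ 0#) → sumTo n g ≈ 0#
  sumTo-zero n g≈0 = trans (sumTo-cong n g≈0) (sumTo-0# n)
    where
    sumTo-0# : ∀ n → sumTo n (λ _ → 0#) ≈ 0#
    sumTo-0# zero    = refl
    sumTo-0# (suc n) = trans (+-congʳ (sumTo-0# n)) (+-identityˡ 0#)

  sumTo-single : ∀ n {g} k → k ℕ.≤ n → (∀ i → i ℕ.≤ n → i ≢ k → g i ≈ 0#) → sumTo n g ≈ g k
  sumTo-single zero    .zero ℕ.z≤n _ = refl
  sumTo-single (suc n) k k≤1+n g≈0 with k ℕP.≟ suc n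
  ... | yes ≡.refl =
    trans (+-congʳ (sumTo-zero n (λ i i≤n → g≈0 i (ℕP.m≤n⇒m≤1+n i≤n) (ℕP.<⇒≢ (ℕ.s≤s i≤n))))) (+-identityˡ _)
  ... | no  k≢1+n  = trans (+-congˡ (g≈0 (suc n) ℕP.≤-refl (k≢1+n ∘ ≡.sym)))
                      (trans (+-identityʳ _) (sumTo-single n k (ℕP.≤-pred (ℕP.≤∧≢⇒< k≤1+n k≢1+n))
                        (λ i i≤n → g≈0 i (ℕP.m≤n⇒m≤1+n i≤n))))

  sumTo-unfoldˡ : ∀ n g → sumTo (suc n) g ≈ g 0 + sumTo n (g ∘ suc)
  sumTo-unfoldˡ zero    g = refl
  sumTo-unfoldˡ (suc n) g = trans (+-congʳ (sumTo-unfoldˡ n g)) (+-assoc _ _ _)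

  sumTo-reverse : ∀ n g → sumTo n g ≈ sumTo n (λ i → g (n ∸ i))
  sumTo-reverse zero    g = refl
  sumTo-reverse (suc n) g = sym (begin
    sumTo (suc n) (λ i → g (suc n ∸ i))  ≈⟨ sumTo-unfoldˡ n _ ⟩
    g (suc n) + sumTo n (λ i → g (n ∸ i)) ≈⟨ +-congˡ (sumTo-reverse n g) ⟨
    g (suc n) + sumTo n g                 ≈⟨ +-comm _ _ ⟩
    sumTo (suc n) g                       ∎)

  sumTo-triangle : ∀ n (G : ℕ → ℕ → Carrier) →
    sumTo n (λ i → sumTo i (λ j → G j i)) ≈ sumTo n (λ j → sumTo (n ∸ j) (λ k → G j (j ℕ.+ k)))
  sumTo-triangle zero    G = refl
  sumTo-triangle (suc n) G = begin
    sumTo n (λ i → sumTo i (λ j → G j i)) + (sumTo n (λ j → G j (suc n)) + G (suc n) (suc n))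
      ≈⟨ +-congʳ (sumTo-triangle n G) ⟩
    sumTo n (λ j → row n j) + (sumTo n (λ j → G j (suc n)) + G (suc n) (suc n))
      ≈⟨ +-assoc _ _ _ ⟨
    (sumTo n (λ j → row n j) + sumTo n (λ j → G j (suc n))) + G (suc n) (suc n)
      ≈⟨ +-congʳ (sumTo-+ n _ _) ⟨
    sumTo n (λ j → row n j + G j (suc n)) + G (suc n) (suc n)
      ≈⟨ +-congʳ (sumTo-cong n extend-row) ⟩
    sumTo n (λ j → row (suc n) j) + G (suc n) (suc n)
      ≈⟨ +-congˡ (reflexive (≡.cong (G (suc n)) (≡.sym (ℕP.+-identityʳ (suc n))))) ⟩
    sumTo n (λ j → row (suc n) j) + sumTo 0 (λ k → G (suc n) (suc n ℕ.+ k))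
      ≡⟨ ≡.cong (λ m → sumTo n (λ j → row (suc n) j) + sumTo m (λ k → G (suc n) (suc n ℕ.+ k)))
                (≡.sym (ℕP.n∸n≡0 n)) ⟩
    sumTo (suc n) (λ j → row (suc n) j)
      ∎
    where
    row : ℕ → ℕ → Carrier
    row m j = sumTo (m ∸ j) (λ k → G j (j ℕ.+ k))

    extend-row : ∀ j → j ℕ.≤ n → row n j + G j (suc n) ≈ row (suc n) j
    extend-row j j≤n = begin
      row n j + G j (suc n)
        ≈⟨ +-congˡ (reflexive (≡.cong (G j) j+[1+n-j]≡1+n)) ⟨
      row n j + G j (j ℕ.+ suc (n ∸ j))
        ≡⟨ ≡.cong (λ m → sumTo m (λ k → G j (j ℕ.+ k))) (≡.sym (ℕP.+-∸-assoc 1 j≤n)) ⟩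
      row (suc n) j
        ∎
      where
      j+[1+n-j]≡1+n : j ℕ.+ suc (n ∸ j) ≡ suc n
      j+[1+n-j]≡1+n = ≡.trans (ℕP.+-suc j (n ∸ j)) (≡.cong suc (ℕP.m+[n∸m]≡n j≤n))

  infix 4 _≈ₚ_
  _≈ₚ_ : PowerSeries → PowerSeries → Set ℓ
  f ≈ₚ g = ∀ n → f n ≈ g n

  infixl 6 _+ₚ_
  _+ₚ_ : PowerSeries → PowerSeries → PowerSeries
  (f +ₚ g) n = f n + g n

  0ₚ : PowerSeries
  0ₚ _ = 0#

  *ₚ-cong : ∀ {f f′ g g′} → f ≈ₚ f′ → g ≈ₚ g′ → f *ₚ g ≈ₚ f′ *ₚ g′
  *ₚ-cong f≈f′ g≈g′ n = sumTo-cong n (λ i _ → *-cong (f≈f′ i) (g≈g′ (n ∸ i)))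

  *ₚ-comm : ∀ f g → f *ₚ g ≈ₚ g *ₚ f
  *ₚ-comm f g n = begin
    sumTo n (λ i → f i * g (n ∸ i))              ≈⟨ sumTo-reverse n _ ⟩
    sumTo n (λ i → f (n ∸ i) * g (n ∸ (n ∸ i)))  ≈⟨ sumTo-cong n (λ i i≤n → trans (*-comm _ _)
                                                      (*-congʳ (reflexive (≡.cong g (ℕP.m∸[m∸n]≡n i≤n))))) ⟩
    sumTo n (λ i → g i * f (n ∸ i))              ∎

  *ₚ-assoc : ∀ f g h → (f *ₚ g) *ₚ h ≈ₚ f *ₚ (g *ₚ h)
  *ₚ-assoc f g h n = begin
    sumTo n (λ i → sumTo i (λ j → f j * g (i ∸ j)) * h (n ∸ i))
      ≈⟨ sumTo-cong n (λ i _ → sumTo-*ʳ i _ _) ⟩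
    sumTo n (λ i → sumTo i (λ j → f j * g (i ∸ j) * h (n ∸ i)))
      ≈⟨ sumTo-triangle n (λ j i → f j * g (i ∸ j) * h (n ∸ i)) ⟩
    sumTo n (λ j → sumTo (n ∸ j) (λ k → f j * g (j ℕ.+ k ∸ j) * h (n ∸ (j ℕ.+ k))))
      ≈⟨ sumTo-cong n (λ j _ → sumTo-cong (n ∸ j) (λ k _ → trans (*-assoc _ _ _)
           (*-congˡ (*-cong (reflexive (≡.cong g (ℕP.m+n∸m≡n j k)))
                            (reflexive (≡.cong h (≡.sym (ℕP.∸-+-assoc n j k)))))))) ⟩
    sumTo n (λ j → sumTo (n ∸ j) (λ k → f j * (g k * h (n ∸ j ∸ k))))
      ≈⟨ sumTo-cong n (λ j _ → sumTo-*ˡ (n ∸ j) _ _) ⟨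
    sumTo n (λ j → f j * sumTo (n ∸ j) (λ k → g k * h (n ∸ j ∸ k)))
      ∎

  *ₚ-identityˡ : ∀ f → oneₚ *ₚ f ≈ₚ f
  *ₚ-identityˡ f n = trans (sumTo-single n 0 ℕ.z≤n higher-terms) (*-identityˡ (f n))
    where
    higher-terms : ∀ i → i ℕ.≤ n → i ≢ 0 → oneₚ i * f (n ∸ i) ≈ 0#
    higher-terms zero    _ i≢0 = ⊥-elim (i≢0 ≡.refl)
    higher-terms (suc i) _ _   = zeroˡ _

  *ₚ-distribʳ : ∀ f g h → (g +ₚ h) *ₚ f ≈ₚ g *ₚ f +ₚ h *ₚ f
  *ₚ-distribʳ f g h n = trans (sumTo-cong n (λ i _ → distribʳ _ _ _)) (sumTo-+ n _ _)

  *ₚ-zeroˡ : ∀ f → 0ₚ *ₚ f ≈ₚ 0ₚ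
  *ₚ-zeroˡ f n = sumTo-zero n (λ i _ → zeroˡ _)

  powerSeries-commutativeSemiring : CommutativeSemiring c ℓ
  powerSeries-commutativeSemiring = record
    { Carrier = PowerSeries
    ; _≈_     = _≈ₚ_
    ; _+_     = _+ₚ_
    ; _*_     = _*ₚ_
    ; 0#      = 0ₚ
    ; 1#      = oneₚ
    ; isCommutativeSemiring = isCommutativeSemiringˡ record
      { +-isCommutativeMonoid = Pointwise.isCommutativeMonoid +-isCommutativeMonoid
      ; *-isCommutativeMonoid = isCommutativeMonoidˡ record
        { isSemigroup = record
          { isMagma = record { isEquivalence = Pointwise.isEquivalence isEquivalence ; ∙-cong = *ₚ-cong }
          ; assoc   = *ₚ-assoc
          }
        ; identityˡ = *ₚ-identityˡ
        ; comm      = *ₚ-comm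
        }
      ; distribʳ = *ₚ-distribʳ
      ; zeroˡ    = *ₚ-zeroˡ
      }
    }

  module PS = CommutativeSemiring powerSeries-commutativeSemiring

  open import Algebra.Properties.Semiring.Exp PS.semiring using (^-congˡ) renaming (_^_ to _^ₛ_)
  open import Algebra.Definitions.RawSemiring PS.rawSemiring using () renaming (_×_ to _×ₚ_)
  open import Algebra.Properties.Monoid.Mult PS.+-monoid using (×-assocˡ)
  open import Algebra.Properties.Monoid.Sum PS.+-monoid using (sum-init-last) renaming (sum to sumₚ)

  ^ₚ≡^ₛ : ∀ f n → f ^ₚ n ≡ f ^ₛ n
  ^ₚ≡^ₛ f zero    = ≡.refl
  ^ₚ≡^ₛ f (suc n) = ≡.cong (f *ₚ_) (^ₚ≡^ₛ f n)

  ×ₚ-coefficient : ∀ m s n → (m ×ₚ s) n ≈ natK Kring m * s n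
  ×ₚ-coefficient zero    s n = sym (zeroˡ (s n))
  ×ₚ-coefficient (suc m) s n = begin
    s n + (m ×ₚ s) n               ≈⟨ +-cong (sym (*-identityˡ (s n))) (×ₚ-coefficient m s n) ⟩
    1# * s n + natK Kring m * s n  ≈⟨ distribʳ (s n) 1# (natK Kring m) ⟨
    natK Kring (suc m) * s n       ∎

  -- Valuations and congruences

  infix 4 _≤ν_ _≤νₚ_ _≡_mod_

  _≤ν_ : ℚ → Carrier → Set
  b ≤ν x = fin b ≤∞ ν x

  _≤νₚ_ : ℚ → PowerSeries → Set
  b ≤νₚ f = ∀ n → b ≤ν f n

  ≤ν-resp-≈ : ∀ {b x y} → x ≈ y → b ≤ν x → b ≤ν y
  ≤ν-resp-≈ {b} x≈y = ≡.subst (fin b ≤∞_) (ν-cong x≈y)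

  ≤-≤ν-trans : ∀ {a b x} → a ≤ b → b ≤ν x → a ≤ν x
  ≤-≤ν-trans a≤b = ≤∞-trans (fin≤fin a≤b)

  ≤ν-0# : ∀ b → b ≤ν 0#
  ≤ν-0# b = ≡.subst (fin b ≤∞_) (≡.sym ν-0) (fin b ≤∞∞)

  ≤ν-+ : ∀ {b x y} → b ≤ν x → b ≤ν y → b ≤ν x + y
  ≤ν-+ b≤x b≤y = ≤∞-trans (⊓∞-glb b≤x b≤y) (ν-+ _ _)

  ≤ν-* : ∀ {a b x y} → a ≤ν x → b ≤ν y → a ℚ.+ b ≤ν x * y
  ≤ν-* {a} {b} {x} {y} a≤x b≤y = ≡.subst (fin (a ℚ.+ b) ≤∞_) (≡.sym (ν-* x y)) (+∞-mono-≤ a≤x b≤y)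

  ≤ν-*ˡ : ∀ {b x y} → 0ℚ ≤ν x → b ≤ν y → b ≤ν x * y
  ≤ν-*ˡ {b} 0≤x b≤y = ≡.subst (_≤ν _) (ℚP.+-identityˡ b) (≤ν-* 0≤x b≤y)

  ≤ν-*ʳ : ∀ {b x y} → b ≤ν x → 0ℚ ≤ν y → b ≤ν x * y
  ≤ν-*ʳ {b} b≤x 0≤y = ≡.subst (_≤ν _) (ℚP.+-identityʳ b) (≤ν-* b≤x 0≤y)

  ν-1# : ν 1# ≡ fin 0ℚ
  ν-1# with ν 1# in ν[1]≡
  ... | ∞     = ⊥-elim (1≉0 (ν-∞ 1# ν[1]≡))
  ... | fin q = ≡.cong fin (ℚ-+-identityʳ-unique q q (fin-injective (≡.sym fin-q≡fin-[q+q])))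
    where
    fin-q≡fin-[q+q] : fin q ≡ fin (q ℚ.+ q)
    fin-q≡fin-[q+q] = ≡.trans (≡.sym ν[1]≡) (≡.trans (ν-cong (sym (*-identityˡ 1#)))
                        (≡.trans (ν-* 1# 1#) (≡.cong₂ _+∞_ ν[1]≡ ν[1]≡)))

  ≤ν-1# : 0ℚ ≤ν 1#
  ≤ν-1# = ≡.subst (fin 0ℚ ≤∞_) (≡.sym ν-1#) ≤∞-refl

  ≤ν-negate : ∀ {b x} → b ≤ν x → b ≤ν - x
  ≤ν-negate {b} {x} b≤x = ≤ν-resp-≈ (-1*x≈-x x) (≤ν-*ˡ 0≤ν[-1] b≤x)
    where
    0≤ν[-1] : 0ℚ ≤ν - 1#
    0≤ν[-1] with ν (- 1#) in ν[-1]≡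
    ... | ∞     = fin 0ℚ ≤∞∞
    ... | fin q = fin≤fin (q+q≡0⇒0≤q q (fin-injective fin-[q+q]≡fin-0))
      where
      fin-[q+q]≡fin-0 : fin (q ℚ.+ q) ≡ fin 0ℚ
      fin-[q+q]≡fin-0 = ≡.trans (≡.sym (≡.cong₂ _+∞_ ν[-1]≡ ν[-1]≡)) (≡.trans (≡.sym (ν-* (- 1#) (- 1#)))
                          (≡.trans (ν-cong (trans (-1*x≈-x (- 1#)) (-‿involutive 1#))) ν-1#))

  ≤ν-natK : ∀ n → 0ℚ ≤ν natK Kring n
  ≤ν-natK zero    = ≤ν-0# 0ℚ
  ≤ν-natK (suc n) = ≤ν-+ ≤ν-1# (≤ν-natK n)

  ≤ν-sumTo : ∀ {b} n g → (∀ i → i ℕ.≤ n → b ≤ν g i) → b ≤ν sumTo n g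
  ≤ν-sumTo zero    g b≤g = b≤g 0 ℕ.z≤n
  ≤ν-sumTo (suc n) g b≤g = ≤ν-+ (≤ν-sumTo n g (λ i i≤n → b≤g i (ℕP.m≤n⇒m≤1+n i≤n))) (b≤g (suc n) ℕP.≤-refl)

  ν-^ : ∀ {x t} → ν x ≡ fin t → ∀ n → ν (x ^ n) ≡ fin (n ×ℚ t)
  ν-^ _          zero    = ν-1#
  ν-^ {x} ν[x]≡t (suc n) = ≡.trans (ν-* x (x ^ n)) (≡.cong₂ _+∞_ ν[x]≡t (ν-^ ν[x]≡t n))

  _≡_mod_ : Carrier → Carrier → ℚ → Set
  x ≡ y mod b = b ≤ν x - y

  ≈⇒≡-mod : ∀ {b x y} → x ≈ y → x ≡ y mod b
  ≈⇒≡-mod {b} x≈y = ≤ν-resp-≈ (sym (x≈y⇒x∙y⁻¹≈ε x≈y)) (≤ν-0# b)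

  ≡-mod-trans : ∀ {b x y z} → x ≡ y mod b → y ≡ z mod b → x ≡ z mod b
  ≡-mod-trans {x = x} {y} {z} x≡y y≡z = ≤ν-resp-≈ telescope (≤ν-+ x≡y y≡z)
    where
    telescope : (x - y) + (y - z) ≈ x - z
    telescope = begin
      (x - y) + (y - z)   ≈⟨ +-assoc x (- y) (y - z) ⟩
      x + (- y + (y - z)) ≈⟨ +-congˡ (+-assoc (- y) y (- z)) ⟨
      x + ((- y + y) - z) ≈⟨ +-congˡ (+-congʳ (-‿inverseˡ y)) ⟩
      x + (0# - z)        ≈⟨ +-congˡ (+-identityˡ (- z)) ⟩
      x - z               ∎

  ≈-≡-mod-trans : ∀ {b x y z} → x ≈ y → y ≡ z mod b → x ≡ z mod b
  ≈-≡-mod-trans x≈y = ≡-mod-trans (≈⇒≡-mod x≈y)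

  ≡-mod-≈-trans : ∀ {b x y z} → x ≡ y mod b → y ≈ z → x ≡ z mod b
  ≡-mod-≈-trans x≡y y≈z = ≡-mod-trans x≡y (≈⇒≡-mod y≈z)

  ≡-mod-+ : ∀ {b x x′ y y′} → x ≡ y mod b → x′ ≡ y′ mod b → x + x′ ≡ y + y′ mod b
  ≡-mod-+ {x = x} {x′} {y} {y′} x≡y x′≡y′ = ≤ν-resp-≈ regroup (≤ν-+ x≡y x′≡y′)
    where
    regroup : (x - y) + (x′ - y′) ≈ (x + x′) - (y + y′)
    regroup = trans (interchange x (- y) x′ (- y′)) (+-congˡ (⁻¹-∙-comm y y′))

  ≡-mod-dropˡ : ∀ {b e y} → b ≤ν e → e + y ≡ y mod b
  ≡-mod-dropˡ {e = e} {y} = ≤ν-resp-≈ (sym [e+y]-y≈e)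
    where
    [e+y]-y≈e : (e + y) - y ≈ e
    [e+y]-y≈e = trans (+-assoc e y (- y)) (trans (+-congˡ (-‿inverseʳ y)) (+-identityʳ e))

  ≡-mod-≤ν : ∀ {b x y} → x ≡ y mod b → b ≤ν x → b ≤ν y
  ≡-mod-≤ν {x = x} {y} x≡y b≤x = ≤ν-resp-≈ x-[x-y]≈y (≤ν-+ b≤x (≤ν-negate x≡y))
    where
    x-[x-y]≈y : x - (x - y) ≈ y
    x-[x-y]≈y = begin
      x - (x - y)   ≈⟨ +-congˡ (⁻¹-anti-homo‿- x y) ⟩
      x + (y - x)   ≈⟨ +-assoc x y (- x) ⟨
      (x + y) - x   ≈⟨ xyx⁻¹≈y x y ⟩
      y             ∎

  private
    e : ℕ
    e = proj₁ discrete

  level : ℕ → ℚ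
  level n = + n / suc e

  ≤ν-level-suc : ∀ n {x} → level n ≤ν x → ν x ≢ fin (level n) → level (suc n) ≤ν x
  ≤ν-level-suc n {x} level≤νx ν≢level with ν x in ν[x]≡
  ... | ∞     = fin (level (suc n)) ≤∞∞
  ... | fin q with proj₂ discrete x q ν[x]≡
  ...   | m , q≡m/e = fin≤fin (≡.subst (level (suc n) ≤_) (≡.sym q≡m/e) (/-≤∧≢⇒suc≤ e n level≤m/e m≢n))
    where
    level≤m/e : level n ≤ m / suc e
    level≤m/e = ≡.subst (level n ≤_) q≡m/e (fin≤fin⁻¹ level≤νx)
    m≢n : m ≢ + n
    m≢n m≡n = ν≢level (≡.cong fin (≡.trans q≡m/e (≡.cong (_/ suc e) m≡n)))

  FinitelyManyBelow-≤ : ∀ {a b f} → a ≤ b → FinitelyManyBelow b f → FinitelyManyBelow a f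
  FinitelyManyBelow-≤ a≤b (N , b≤tail) = N , λ n N≤n → ≤-≤ν-trans a≤b (b≤tail n N≤n)

  ≤νₚ-resp-≈ₚ : ∀ {b f g} → f ≈ₚ g → b ≤νₚ f → b ≤νₚ g
  ≤νₚ-resp-≈ₚ f≈g b≤f n = ≤ν-resp-≈ (f≈g n) (b≤f n)

  ≤νₚ-*ˡ : ∀ {b f g} → 0ℚ ≤νₚ f → b ≤νₚ g → b ≤νₚ f *ₚ g
  ≤νₚ-*ˡ 0≤f b≤g n = ≤ν-sumTo n _ (λ i _ → ≤ν-*ˡ (0≤f i) (b≤g (n ∸ i)))

  ≤νₚ-*ʳ : ∀ {b f g} → b ≤νₚ f → 0ℚ ≤νₚ g → b ≤νₚ f *ₚ g
  ≤νₚ-*ʳ b≤f 0≤g n = ≤ν-sumTo n _ (λ i _ → ≤ν-*ʳ (b≤f i) (0≤g (n ∸ i)))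

  ≤νₚ-oneₚ : 0ℚ ≤νₚ oneₚ
  ≤νₚ-oneₚ zero    = ≤ν-1#
  ≤νₚ-oneₚ (suc _) = ≤ν-0# 0ℚ

  ≤νₚ-^ₛ : ∀ {f} → 0ℚ ≤νₚ f → ∀ k → 0ℚ ≤νₚ f ^ₛ k
  ≤νₚ-^ₛ 0≤f zero    = ≤νₚ-oneₚ
  ≤νₚ-^ₛ 0≤f (suc k) = ≤νₚ-*ˡ 0≤f (≤νₚ-^ₛ 0≤f k)

  ≤νₚ-^ₛ-pos : ∀ {t f k} → 0ℚ ≤νₚ f → t ≤νₚ f → 0 ℕ.< k → t ≤νₚ f ^ₛ k
  ≤νₚ-^ₛ-pos {k = suc k} 0≤f t≤f _ = ≤νₚ-*ʳ t≤f (≤νₚ-^ₛ 0≤f k)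

  ≤νₚ-×ₚ : ∀ {b s} m → b ≤νₚ s → b ≤νₚ m ×ₚ s
  ≤νₚ-×ₚ {b} zero    _   _ = ≤ν-0# b
  ≤νₚ-×ₚ     (suc m) b≤s n = ≤ν-+ (b≤s n) (≤νₚ-×ₚ m b≤s n)

  ≤νₚ-sumₚ : ∀ {b} n (v : Fin n → PowerSeries) → (∀ i → b ≤νₚ v i) → b ≤νₚ sumₚ v
  ≤νₚ-sumₚ {b} zero    v _     _ = ≤ν-0# b
  ≤νₚ-sumₚ     (suc n) v b≤v j = ≤ν-+ (b≤v Fin.zero j) (≤νₚ-sumₚ n (v ∘ Fin.suc) (b≤v ∘ Fin.suc) j)

  ≤νₚ-1+ₚ : ∀ {a} → (∀ j → 0ℚ ≤ν a j) → 0ℚ ≤νₚ 1+ₚ a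
  ≤νₚ-1+ₚ 0≤a zero    = ≤ν-+ ≤ν-1# (0≤a zero)
  ≤νₚ-1+ₚ 0≤a (suc j) = 0≤a (suc j)

  Degree≤ : ℕ → PowerSeries → Set ℓ
  Degree≤ d f = ∀ n → d ℕ.< n → f n ≈ 0#

  Degree≤-* : ∀ {d d′ f g} → Degree≤ d f → Degree≤ d′ g → Degree≤ (d ℕ.+ d′) (f *ₚ g)
  Degree≤-* {d} {d′} {f} {g} deg-f deg-g n d+d′<n = sumTo-zero n term≈0
    where
    term≈0 : ∀ i → i ℕ.≤ n → f i * g (n ∸ i) ≈ 0#
    term≈0 i _ with d ℕ.<? i
    ... | yes d<i = trans (*-congʳ (deg-f i d<i)) (zeroˡ _)
    ... | no  d≮i = trans (*-congˡ (deg-g (n ∸ i) d′<n∸i)) (zeroʳ _)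
      where
      d′<n∸i : d′ ℕ.< n ∸ i
      d′<n∸i = ℕP.m+n≤o⇒m≤o∸n (suc d′) (ℕP.≤-trans (ℕP.+-monoʳ-≤ (suc d′) (ℕP.≮⇒≥ d≮i))
                                         (ℕP.≤-trans (ℕ.s≤s (ℕP.≤-reflexive (ℕP.+-comm d′ d))) d+d′<n))

  Degree≤-^ₚ : ∀ {d f} → Degree≤ d f → ∀ k → Degree≤ (k ℕ.* d) (f ^ₚ k)
  Degree≤-^ₚ deg-f zero    (suc n) _ = refl
  Degree≤-^ₚ deg-f (suc k)           = Degree≤-* deg-f (Degree≤-^ₚ deg-f k)

  AgreeUpTo : ℕ → PowerSeries → PowerSeries → Set ℓ
  AgreeUpTo m f g = ∀ n → n ℕ.≤ m → f n ≈ g n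

  *ₚ-cong-upTo : ∀ {m f f′ g g′} → AgreeUpTo m f f′ → AgreeUpTo m g g′ → AgreeUpTo m (f *ₚ g) (f′ *ₚ g′)
  *ₚ-cong-upTo f≈f′ g≈g′ n n≤m = sumTo-cong n (λ i i≤n →
    *-cong (f≈f′ i (ℕP.≤-trans i≤n n≤m)) (g≈g′ (n ∸ i) (ℕP.≤-trans (ℕP.m∸n≤m n i) n≤m)))

  ^ₚ-cong-upTo : ∀ {m f f′} → AgreeUpTo m f f′ → ∀ k → AgreeUpTo m (f ^ₚ k) (f′ ^ₚ k)
  ^ₚ-cong-upTo f≈f′ zero    n _ = refl
  ^ₚ-cong-upTo f≈f′ (suc k)     = *ₚ-cong-upTo f≈f′ (^ₚ-cong-upTo f≈f′ k)

  monomial : Carrier → ℕ → PowerSeries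
  monomial x m n with n ℕP.≟ m
  ... | yes _ = x
  ... | no  _ = 0#

  monomial-≡ : ∀ x m → monomial x m m ≈ x
  monomial-≡ x m with m ℕP.≟ m
  ... | yes _   = refl
  ... | no  m≢m = ⊥-elim (m≢m ≡.refl)

  monomial-≢ : ∀ x {m n} → n ≢ m → monomial x m n ≈ 0#
  monomial-≢ x {m} {n} n≢m with n ℕP.≟ m
  ... | yes n≡m = ⊥-elim (n≢m n≡m)
  ... | no  _   = refl

  ≤νₚ-monomial : ∀ {b x} m → b ≤ν x → b ≤νₚ monomial x m
  ≤νₚ-monomial {b} m b≤x n with n ℕP.≟ m
  ... | yes _ = b≤x
  ... | no  _ = ≤ν-0# b

  monomial-*ₚ : ∀ x m y n → monomial x m *ₚ monomial y n ≈ₚ monomial (x * y) (m ℕ.+ n)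
  monomial-*ₚ x m y n k with k ℕP.≟ m ℕ.+ n
  ... | yes ≡.refl = begin
    sumTo (m ℕ.+ n) (λ i → monomial x m i * monomial y n (m ℕ.+ n ∸ i))
      ≈⟨ sumTo-single (m ℕ.+ n) m (ℕP.m≤m+n m n) (λ i _ i≢m → trans (*-congʳ (monomial-≢ x i≢m)) (zeroˡ _)) ⟩
    monomial x m m * monomial y n (m ℕ.+ n ∸ m)
      ≈⟨ *-cong (monomial-≡ x m) (trans (reflexive (≡.cong (monomial y n) (ℕP.m+n∸m≡n m n))) (monomial-≡ y n)) ⟩
    x * y
      ∎
  ... | no k≢m+n = sumTo-zero k term≈0
    where
    term≈0 : ∀ i → i ℕ.≤ k → monomial x m i * monomial y n (k ∸ i) ≈ 0#
    term≈0 i i≤k with i ℕP.≟ m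
    ... | no  _      = zeroˡ _
    ... | yes ≡.refl = trans (*-congˡ (monomial-≢ y (λ k-i≡n → k≢m+n
                         (≡.trans (≡.sym (ℕP.m+[n∸m]≡n i≤k)) (≡.cong (i ℕ.+_) k-i≡n))))) (zeroʳ _)

  monomial-^ₚ : ∀ x m k → monomial x m ^ₚ k ≈ₚ monomial (x ^ k) (k ℕ.* m)
  monomial-^ₚ x m zero    zero    = sym (monomial-≡ 1# 0)
  monomial-^ₚ x m zero    (suc n) = sym (monomial-≢ 1# {0} {suc n} (λ ()))
  monomial-^ₚ x m (suc k) n       =
    trans (*ₚ-cong (λ _ → refl) (monomial-^ₚ x m k) n) (monomial-*ₚ x m (x ^ k) (k ℕ.* m) n)

  monomial-scale : ∀ x c m n → monomial x (suc c ℕ.* m) (suc c ℕ.* n) ≈ monomial x m n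
  monomial-scale x c m n with n ℕP.≟ m
  ... | yes ≡.refl = monomial-≡ x (suc c ℕ.* n)
  ... | no  n≢m    = monomial-≢ x (n≢m ∘ ℕP.*-cancelˡ-≡ n m (suc c))

  truncate : ℕ → PowerSeries → PowerSeries
  truncate m f n with n ℕ.≤? m
  ... | yes _ = f n
  ... | no  _ = 0#

  ≤νₚ-truncate : ∀ {b f} m → b ≤νₚ f → b ≤νₚ truncate m f
  ≤νₚ-truncate {b} m b≤f n with n ℕ.≤? m
  ... | yes _ = b≤f n
  ... | no  _ = ≤ν-0# b

  Degree≤-truncate : ∀ m f → Degree≤ m (truncate m f)
  Degree≤-truncate m f n m<n with n ℕ.≤? m
  ... | yes n≤m = ⊥-elim (ℕP.<⇒≱ m<n n≤m)
  ... | no  _   = refl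

  truncate-≤ : ∀ {m n} f → n ℕ.≤ m → truncate m f n ≈ f n
  truncate-≤ {m} {n} f n≤m with n ℕ.≤? m
  ... | yes _   = refl
  ... | no  n≰m = ⊥-elim (n≰m n≤m)

  truncate-suc : ∀ m f → truncate (suc m) f ≈ₚ truncate m f +ₚ monomial (f (suc m)) (suc m)
  truncate-suc m f n with ℕP.<-cmp n (suc m)
  ... | tri< n<1+m n≢1+m _ = begin
    truncate (suc m) f n                           ≈⟨ truncate-≤ f (ℕP.<⇒≤ n<1+m) ⟩
    f n                                            ≈⟨ +-identityʳ (f n) ⟨
    f n + 0#                                       ≈⟨ +-cong (truncate-≤ f (ℕP.≤-pred n<1+m)) (monomial-≢ _ n≢1+m) ⟨
    truncate m f n + monomial (f (suc m)) (suc m) n ∎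
  ... | tri≈ _ ≡.refl _ = begin
    truncate (suc m) f (suc m)                                 ≈⟨ truncate-≤ f ℕP.≤-refl ⟩
    f (suc m)                                                  ≈⟨ +-identityˡ (f (suc m)) ⟨
    0# + f (suc m)                                             ≈⟨ +-cong (Degree≤-truncate m f (suc m) ℕP.≤-refl)
                                                                         (monomial-≡ (f (suc m)) (suc m)) ⟨
    truncate m f (suc m) + monomial (f (suc m)) (suc m) (suc m) ∎
  ... | tri> _ n≢1+m 1+m<n = begin
    truncate (suc m) f n                            ≈⟨ Degree≤-truncate (suc m) f n 1+m<n ⟩
    0#                                              ≈⟨ +-identityˡ 0# ⟨
    0# + 0#                                         ≈⟨ +-cong (Degree≤-truncate m f n (ℕP.<-trans (ℕP.n<1+n m) 1+m<n))
                                                              (monomial-≢ _ n≢1+m) ⟨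
    truncate m f n + monomial (f (suc m)) (suc m) n ∎

  -- The Frobenius congruence and the main argument

  -- The prime is taken in the form 2 + k, so that p - 1 = 1 + k and `_/⟨_-1⟩` computes.
  module _ (k : ℕ) (p-prime : Prime (suc (suc k))) (ν-p≡1 : ν (natK Kring (suc (suc k))) ≡ fin 1ℚ) where
    private
      p : ℕ
      p = suc (suc k)

    open import Algebra.Properties.CommutativeSemiring.Binomial powerSeries-commutativeSemiring
      using (binomialTerm) renaming (theorem to binomial-theorem)

    module _ {F u : PowerSeries} where

      binomialTerm-first : binomialTerm u F p Fin.zero ≈ₚ F ^ₚ p
      binomialTerm-first n = begin
        (oneₚ *ₚ (F ^ₛ p)) n + 0#  ≈⟨ +-identityʳ _ ⟩
        (oneₚ *ₚ (F ^ₛ p)) n       ≈⟨ *ₚ-identityˡ (F ^ₛ p) n ⟩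
        (F ^ₛ p) n                 ≡⟨ ≡.cong (_$ n) (^ₚ≡^ₛ F p) ⟨
        (F ^ₚ p) n                 ∎

      binomialTerm-last : ∀ r → Fin.toℕ r ≡ p → binomialTerm u F p r ≈ₚ u ^ₚ p
      binomialTerm-last r toℕ[r]≡p n rewrite toℕ[r]≡p | nCn≡1 p | ℕP.n∸n≡0 p =
        trans (+-identityʳ _) (trans (PS.*-identityʳ (u ^ₛ p) n) (reflexive (≡.cong (_$ n) (≡.sym (^ₚ≡^ₛ u p)))))

      binomialTerm-inner : ∀ {t} → 0ℚ ≤νₚ F → 0ℚ ≤νₚ u → t ≤νₚ u →
                           ∀ r → 0 ℕ.< Fin.toℕ r → Fin.toℕ r ℕ.< p → 1ℚ ℚ.+ t ≤νₚ binomialTerm u F p r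
      binomialTerm-inner {t} 0≤F 0≤u t≤u r 0<r r<p with p∣pCk p-prime 0<r r<p
      ... | divides m pCr≡m*p =
        ≤νₚ-resp-≈ₚ (λ n → trans (×-assocˡ s m p n) (reflexive (≡.cong (λ j → (j ×ₚ s) n) (≡.sym pCr≡m*p))))
          (≤νₚ-×ₚ m (λ n → ≤ν-resp-≈ (sym (×ₚ-coefficient p s n)) (≤ν-* 1≤ν[p] (t≤s n))))
        where
        s : PowerSeries
        s = (u ^ₛ Fin.toℕ r) *ₚ (F ^ₛ (p ∸ Fin.toℕ r))
        t≤s : t ≤νₚ s
        t≤s = ≤νₚ-*ʳ (≤νₚ-^ₛ-pos 0≤u t≤u 0<r) (≤νₚ-^ₛ 0≤F (p ∸ Fin.toℕ r))
        1≤ν[p] : 1ℚ ≤ν natK Kring p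
        1≤ν[p] = ≡.subst (fin 1ℚ ≤∞_) (≡.sym ν-p≡1) ≤∞-refl

    frobenius : ∀ {t F u} → 0ℚ ≤νₚ F → 0ℚ ≤νₚ u → t ≤νₚ u → ∀ n →
                ((F +ₚ u) ^ₚ p) n ≡ (F ^ₚ p) n + (u ^ₚ p) n mod (1ℚ ℚ.+ t)
    frobenius {t} {F} {u} 0≤F 0≤u t≤u n =
      ≡-mod-trans (≈⇒≡-mod expansion)
        (≡-mod-+ (≈⇒≡-mod refl) (≡-mod-dropˡ (≤νₚ-sumₚ (suc k) inner 1+t≤inner n)))
      where
      inner : Fin (suc k) → PowerSeries
      inner i = binomialTerm u F p (Fin.suc (Fin.inject₁ i))

      1+t≤inner : ∀ i → 1ℚ ℚ.+ t ≤νₚ inner i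
      1+t≤inner i = binomialTerm-inner 0≤F 0≤u t≤u _ (ℕ.s≤s ℕ.z≤n) (ℕ.s≤s (FinP.inject₁ℕ< i))

      expansion : ((F +ₚ u) ^ₚ p) n ≈ (F ^ₚ p) n + (sumₚ inner n + (u ^ₚ p) n)
      expansion = begin
        ((F +ₚ u) ^ₚ p) n
          ≡⟨ ≡.cong (_$ n) (^ₚ≡^ₛ (F +ₚ u) p) ⟩
        ((F +ₚ u) ^ₛ p) n
          ≈⟨ ^-congˡ p (PS.+-comm F u) n ⟩
        ((u +ₚ F) ^ₛ p) n
          ≈⟨ binomial-theorem p u F n ⟩
        binomialTerm u F p Fin.zero n + sumₚ (binomialTerm u F p ∘ Fin.suc) n
          ≈⟨ +-congˡ (sum-init-last (binomialTerm u F p ∘ Fin.suc) n) ⟩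
        binomialTerm u F p Fin.zero n + (sumₚ inner n + binomialTerm u F p (Fin.suc (Fin.fromℕ (suc k))) n)
          ≈⟨ +-cong (binomialTerm-first {u = u} n)
                    (+-congˡ (binomialTerm-last _ (≡.cong suc (FinP.toℕ-fromℕ (suc k))) n)) ⟩
        (F ^ₚ p) n + (sumₚ inner n + (u ^ₚ p) n)
          ∎

    module _ {f : PowerSeries} {t : ℚ} {N : ℕ} (0≤f : 0ℚ ≤νₚ f) (t≤tail : ∀ j → N ℕ.< j → t ≤ν f j) where

      truncate-frobenius : ∀ {i} → N ℕ.< i → ∀ m → N ℕ.≤′ m →
        (truncate m f ^ₚ p) (p ℕ.* i) ≡ truncate m (λ j → f j ^ p) i mod (1ℚ ℚ.+ t)
      truncate-frobenius {i} N<i .N ℕ.≤′-refl = ≈⇒≡-mod (begin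
        (truncate N f ^ₚ p) (p ℕ.* i)  ≈⟨ Degree≤-^ₚ (Degree≤-truncate N f) p (p ℕ.* i) (ℕP.*-monoʳ-< p N<i) ⟩
        0#                             ≈⟨ Degree≤-truncate N _ i N<i ⟨
        truncate N (λ j → f j ^ p) i   ∎)
      truncate-frobenius {i} N<i (suc m) (ℕ.≤′-step N≤′m) =
        ≈-≡-mod-trans (^ₚ-cong-upTo (λ n _ → truncate-suc m f n) p (p ℕ.* i) ℕP.≤-refl)
          (≡-mod-trans (frobenius (≤νₚ-truncate m 0≤f) (≤νₚ-monomial (suc m) (0≤f (suc m))) t≤u (p ℕ.* i))
          (≡-mod-≈-trans (≡-mod-+ (truncate-frobenius N<i m N≤′m) (≈⇒≡-mod u^p-coefficient))
            (sym (truncate-suc m (λ j → f j ^ p) i))))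
        where
        u : PowerSeries
        u = monomial (f (suc m)) (suc m)

        t≤u : t ≤νₚ u
        t≤u = ≤νₚ-monomial (suc m) (t≤tail (suc m) (ℕ.s≤s (ℕP.≤′⇒≤ N≤′m)))

        u^p-coefficient : (u ^ₚ p) (p ℕ.* i) ≈ monomial (f (suc m) ^ p) (suc m) i
        u^p-coefficient = trans (monomial-^ₚ (f (suc m)) (suc m) p (p ℕ.* i)) (monomial-scale _ (suc k) (suc m) i)

      coefficient-frobenius : ∀ {i} → N ℕ.< i → (f ^ₚ p) (p ℕ.* i) ≡ f i ^ p mod (1ℚ ℚ.+ t)
      coefficient-frobenius {i} N<i =
        ≈-≡-mod-trans (^ₚ-cong-upTo (λ n n≤pi → sym (truncate-≤ f n≤pi)) p (p ℕ.* i) ℕP.≤-refl)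
          (≡-mod-≈-trans (truncate-frobenius N<i (p ℕ.* i) (ℕP.≤⇒≤′ N≤pi)) (truncate-≤ _ i≤pi))
        where
        i≤pi : i ℕ.≤ p ℕ.* i
        i≤pi = ℕP.m≤n*m i p
        N≤pi : N ℕ.≤ p ℕ.* i
        N≤pi = ℕP.≤-trans (ℕP.<⇒≤ N<i) i≤pi

    module _ {f : PowerSeries} (0≤f : 0ℚ ≤νₚ f) (f^p-bound : FinitelyManyBelow (+ p / suc k) (f ^ₚ p)) where

      T : ℚ
      T = + 1 / suc k

      valuation-eventually-≢ : ∀ {t} → t < T → FinitelyManyBelow t f →
                               ∃ λ N → ∀ i → N ℕ.≤ i → ν (f i) ≢ fin t
      valuation-eventually-≢ {t} t<T (N , t≤tail) = suc N ℕ.+ M , ν≢t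
        where
        M : ℕ
        M = proj₁ f^p-bound

        ν≢t : ∀ i → suc N ℕ.+ M ℕ.≤ i → ν (f i) ≢ fin t
        ν≢t i N+M≤i ν[fi]≡t =
          ℚP.<-irrefl ≡.refl (ℚP.<-≤-trans (⊓-glb-strict (p×t<p/[p-1] k t<T) (p×t<1+t k t<T)) (fin≤fin⁻¹ b≤p×t))
          where
          b : ℚ
          b = (+ p / suc k) ℚ.⊓ (1ℚ ℚ.+ t)
          N<i : N ℕ.< i
          N<i = ℕP.≤-trans (ℕP.m≤m+n (suc N) M) N+M≤i
          M≤pi : M ℕ.≤ p ℕ.* i
          M≤pi = ℕP.≤-trans (ℕP.≤-trans (ℕP.m≤n+m M (suc N)) N+M≤i) (ℕP.m≤n*m i p)
          b≤ν[fi^p] : b ≤ν f i ^ p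
          b≤ν[fi^p] = ≡-mod-≤ν
            (≤-≤ν-trans (ℚP.p⊓q≤q (+ p / suc k) _)
              (coefficient-frobenius 0≤f (λ j N<j → t≤tail j (ℕP.<⇒≤ N<j)) N<i))
            (≤-≤ν-trans (ℚP.p⊓q≤p _ (1ℚ ℚ.+ t)) (proj₂ f^p-bound (p ℕ.* i) M≤pi))
          b≤p×t : fin b ≤∞ fin (p ×ℚ t)
          b≤p×t = ≡.subst (fin b ≤∞_) (ν-^ ν[fi]≡t p) b≤ν[fi^p]

      FinitelyManyBelow-level-suc : ∀ n → level n < T → FinitelyManyBelow (level n) f → FinitelyManyBelow (level (suc n)) f
      FinitelyManyBelow-level-suc n level<T (N , level≤tail) = N ℕ.+ N′ , λ j N+N′≤j →
        ≤ν-level-suc n (level≤tail j (ℕP.≤-trans (ℕP.m≤m+n N N′) N+N′≤j))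
                       (ν≢level j (ℕP.≤-trans (ℕP.m≤n+m N′ N) N+N′≤j))
        where
        N′ : ℕ
        N′ = proj₁ (valuation-eventually-≢ level<T (N , level≤tail))
        ν≢level : ∀ i → N′ ℕ.≤ i → ν (f i) ≢ fin (level n)
        ν≢level = proj₂ (valuation-eventually-≢ level<T (N , level≤tail))

      FinitelyManyBelow-level⊓T : ∀ n → FinitelyManyBelow (level n ℚ.⊓ T) f
      FinitelyManyBelow-level⊓T zero =
        0 , λ j _ → ≤-≤ν-trans (ℚP.≤-trans (ℚP.p⊓q≤p (level 0) T) (ℚP.≤-reflexive (ℚP.0/n≡0 (suc e))))
                               (0≤f j)
      FinitelyManyBelow-level⊓T (suc n) with level n ℚP.<? T
      ... | yes level<T =
        FinitelyManyBelow-≤ (ℚP.p⊓q≤p (level (suc n)) T) (FinitelyManyBelow-level-suc n level<T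
          (FinitelyManyBelow-≤ (ℚP.⊓-glb ℚP.≤-refl (ℚP.<⇒≤ level<T)) (FinitelyManyBelow-level⊓T n)))
      ... | no  level≮T =
        FinitelyManyBelow-≤ (ℚP.⊓-glb (ℚP.≤-trans (ℚP.p⊓q≤q (level (suc n)) T) (ℚP.≮⇒≥ level≮T))
                                      (ℚP.p⊓q≤q (level (suc n)) T))
          (FinitelyManyBelow-level⊓T n)

      FinitelyManyBelow-T : FinitelyManyBelow T f
      FinitelyManyBelow-T =
        FinitelyManyBelow-≤ (ℚP.⊓-glb (ℚP.≤-trans (1/n≤1 k) (ℚP.≤-reflexive (≡.sym (n/n≡1 e)))) ℚP.≤-refl)
          (FinitelyManyBelow-level⊓T (suc e))

  FinitelyManyBelow-p/[p-1]⇒1/[p-1] : ∀ {q} → Prime q → ν (natK Kring q) ≡ fin 1ℚ → ∀ {f} → 0ℚ ≤νₚ f →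
    FinitelyManyBelow ((+ q) /⟨ q -1⟩) (f ^ₚ q) → FinitelyManyBelow ((+ 1) /⟨ q -1⟩) f
  FinitelyManyBelow-p/[p-1]⇒1/[p-1] {suc (suc k)} = FinitelyManyBelow-T k

proposition4p4 : ∀ {c ℓ : Level} (K : MixedCharDVF c ℓ) →
    let open MixedCharDVF K in
    (a : ℕ → Carrier) →
    (∀ j → fin 0ℚ <∞ ν (a j)) →
    (∃ λ (B : ℚ) → (0ℚ < B) × (∀ j → fin B ≤∞ ν (a j))) →
    FinitelyManyBelow ((+ p) /⟨ p -1⟩) (1+ₚ a ^ₚ p) →
    FinitelyManyBelow ((+ 1) /⟨ p -1⟩) (1+ₚ a)
proposition4p4 K a 0<a _ =
  FinitelyManyBelow-p/[p-1]⇒1/[p-1] K p-prime ν-p (≤νₚ-1+ₚ K (<∞⇒≤∞ ∘ 0<a))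
  where
  open MixedCharDVF K using (p-prime; ν-p)
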